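{- For every cycle $C_n$ ($n\ge 3$), $\mathrm{Maj}'(C_n)=2$ if $n\equiv 0 \pmod 4$, and $\mathrm{Maj}'(C_n)=3$ otherwise.
   Context: Graphs are finite, simple and undirected. Two distinct edges are adjacent if they share an endpoint. An edge-coloring $c:E\to C$ (not necessarily proper) of a graph $G=(V,E)$ is a strong majority edge-coloring if for every edge $e\in E$ and every color $\alpha\in C$, at most half of the edges adjacent to $e$ have color $\alpha$. The strong majority index $\mathrm{Maj}'(G)$ is the least number of colors in such a coloring. -}

module Defs where

open import Data.Nat using (ℕ; zero; suc; _*_; _≤_; _<_; _%_)
open import Data.Nat.DivMod using (m%n<n)
open import Data.Fin using (Fin; toℕ; fromℕ<)
open import Data.Fin.Properties using (_≟_)
open import Data.Product using (_×_; _,_; proj₁; proj₂; ∃)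
open import Data.Sum using (_⊎_)
open import Data.List using (List; length; filter)
open import Data.List.Base using (allFin)
open import Relation.Nullary using (¬_; Dec)
open import Relation.Nullary.Decidable using (_×-dec_; _⊎-dec_; ¬?)
open import Relation.Binary.PropositionalEquality using (_≡_)

record Graph : Set where
  field
    V    : ℕ
    E    : ℕ
    ends : Fin E → Fin V × Fin V

open Graph public

ShareEnd : (G : Graph) → Fin (E G) → Fin (E G) → Set
ShareEnd G e f =
  let (a , b) = ends G e ; (c , d) = ends G f in
  (a ≡ c ⊎ a ≡ d) ⊎ (b ≡ c ⊎ b ≡ d)

Adjacent : (G : Graph) → Fin (E G) → Fin (E G) → Set
Adjacent G e f = (¬ e ≡ f) × ShareEnd G e f

adjacent? : (G : Graph) → (e f : Fin (E G)) → Dec (Adjacent G e f)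
adjacent? G e f with ends G e | ends G f
... | (a , b) | (c , d) =
  ¬? (e ≟ f) ×-dec (((a ≟ c) ⊎-dec (a ≟ d)) ⊎-dec ((b ≟ c) ⊎-dec (b ≟ d)))

adjEdges : (G : Graph) → Fin (E G) → List (Fin (E G))
adjEdges G e = filter (adjacent? G e) (allFin (E G))

adjEdgesOfColor : (G : Graph) {k : ℕ} → (Fin (E G) → Fin k) →
                  Fin (E G) → Fin k → List (Fin (E G))
adjEdgesOfColor G c e α =
  filter (λ f → adjacent? G e f ×-dec (c f ≟ α)) (allFin (E G))

IsStrongMajority : (G : Graph) {k : ℕ} → (Fin (E G) → Fin k) → Set
IsStrongMajority G {k} c =
  (e : Fin (E G)) (α : Fin k) →
  2 * length (adjEdgesOfColor G c e α) ≤ length (adjEdges G e)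

HasStrongMajorityColoring : Graph → ℕ → Set
HasStrongMajorityColoring G k = ∃ λ (c : Fin (E G) → Fin k) → IsStrongMajority G c

MajIndexIs : Graph → ℕ → Set
MajIndexIs G k =
  HasStrongMajorityColoring G k ×
  ((j : ℕ) → j < k → ¬ HasStrongMajorityColoring G j)

next : {n : ℕ} → Fin n → Fin n
next {suc m} i = fromℕ< (m%n<n (suc (toℕ i)) (suc m))

cycle : ℕ → Graph
cycle n = record { V = n ; E = n ; ends = λ i → (i , next i) }

{-# OPTIONS --safe #-}
-- In C_n with n ≥ 3 every edge has exactly two neighbours, its predecessor and its successor,
-- so a coloring is strong majority iff the two neighbours of each edge get different colors,
-- i.e. c i ≢ c (i + 2) for all i modulo n. With two colors this forces c (i + 2) to be the
-- other color of c i, so c (i + 4) = c i; closing up the cycle along steps of 2 then forces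
-- 4 ∣ n, and conversely the pattern 0011 repeated works when 4 ∣ n. Three colors always
-- suffice: repeat 0011 on all but the last two edges and give those the third color (for
-- n = 3, color the three edges differently).
module Submission where

open import Defs
open import Data.Fin using (Fin; zero; suc; toℕ; fromℕ; inject₁; inject≤)
open import Data.Fin.Properties
  using (toℕ-fromℕ<; toℕ-injective; toℕ<n; fromℕ<-cong; fromℕ≢inject₁; inject₁-injective;
         inject≤-injective)
open import Data.List using (_∷_; length; filter; allFin)
open import Data.List.Membership.Propositional using (_∈_)
open import Data.List.Membership.Propositional.Properties using (∈-filter⁺; ∈-allFin)
open import Data.List.Relation.Unary.All as All using (All; _∷_)
open import Data.List.Relation.Unary.All.Properties using (all-filter)
open import Data.List.Relation.Unary.AllPairs using ([]; _∷_)
open import Data.List.Relation.Unary.Any using (here; there)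
open import Data.List.Relation.Unary.Unique.Propositional using (Unique)
import Data.List.Relation.Unary.Unique.Propositional.Properties as Unique
open import Data.Nat using (ℕ; zero; suc; _+_; _*_; _%_; _≤_; _<_; _<?_; z≤n; s≤s; s≤s⁻¹)
open import Data.Nat.DivMod
  using (_mod_; m<n⇒m%n≡m; n%n≡0; m%n%n≡m%n; [m+n]%n≡m%n; %-distribˡ-+; %-remove-+ˡ)
open import Data.Nat.Divisibility using (_∣_; divides; n∣n; m%n≡0⇒n∣m; n∣m⇒m%n≡0)
open import Data.Nat.Properties
  using (≤-antisym; m≤n⇒m≤1+n; <-cmp; <-irrefl; <-asym; n<1+n; m≤m+n; m≢1+n+m; +-suc;
         +-comm; +-identityʳ; *-comm; *-assoc; *-distribˡ-+; *-monoʳ-≤; module ≤-Reasoning)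
open import Data.Product using (_×_; _,_)
open import Data.Sum using (_⊎_; inj₁; inj₂; swap)
open import Function using (id; _∘_; case_of_)
open import Relation.Binary using (tri<; tri≈; tri>)
open import Relation.Binary.PropositionalEquality
  using (_≡_; _≢_; refl; sym; trans; cong; subst; ≢-sym; module ≡-Reasoning)
open import Relation.Nullary using (¬_; yes; no; contradiction)
open import Relation.Unary using (_∪_)

module _ {A : Set} where

  AtMostOne : (A → Set) → Set
  AtMostOne P = ∀ {x y} → P x → P y → x ≡ y

  ≢-∈⇒2≤length : ∀ {x y : A} {xs} → x ≢ y → x ∈ xs → y ∈ xs → 2 ≤ length xs
  ≢-∈⇒2≤length x≢y (here refl)           (here refl)           = contradiction refl x≢y
  ≢-∈⇒2≤length _   (here _)               (there {xs = _ ∷ _} _) = s≤s (s≤s z≤n)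
  ≢-∈⇒2≤length _   (there {xs = _ ∷ _} _) (here _)               = s≤s (s≤s z≤n)
  ≢-∈⇒2≤length x≢y (there x∈xs)           (there y∈xs)           =
    m≤n⇒m≤1+n (≢-∈⇒2≤length x≢y x∈xs y∈xs)

  AtMostOne⇒length≤1 : ∀ {P : A → Set} {xs} → AtMostOne P → Unique xs → All P xs → length xs ≤ 1
  AtMostOne⇒length≤1 _   []                  _              = z≤n
  AtMostOne⇒length≤1 _   (_ ∷ [])            _              = s≤s z≤n
  AtMostOne⇒length≤1 one ((x≢y ∷ _) ∷ _ ∷ _) (px ∷ py ∷ _) = contradiction (one px py) x≢y

  private
    outside : ∀ {P Q : A → Set} {x} → AtMostOne P → P x → ∀ {y} → x ≢ y × (P ∪ Q) y → Q y
    outside oneP px (x≢y , inj₁ py) = contradiction (oneP px py) x≢y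
    outside oneP px (_   , inj₂ qy) = qy

  -- Once the head lies in P, every other element lies in Q (and symmetrically).
  AtMostOne-∪⇒length≤2 : ∀ {P Q : A → Set} {xs} → AtMostOne P → AtMostOne Q →
                         Unique xs → All (P ∪ Q) xs → length xs ≤ 2
  AtMostOne-∪⇒length≤2 _ _ [] _ = z≤n
  AtMostOne-∪⇒length≤2 {Q = Q} oneP oneQ (x≢xs ∷ unique) (inj₁ px ∷ pq) =
    s≤s (AtMostOne⇒length≤1 oneQ unique (All.zipWith (outside {Q = Q} oneP px) (x≢xs , pq)))
  AtMostOne-∪⇒length≤2 {P = P} oneP oneQ (x≢xs ∷ unique) (inj₂ qx ∷ pq) =
    s≤s (AtMostOne⇒length≤1 oneP unique
      (All.zipWith (outside {Q = P} oneQ qx) (x≢xs , All.map swap pq)))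

module _ (G : Graph) where

  adjEdges-unique : ∀ e → Unique (adjEdges G e)
  adjEdges-unique e = Unique.filter⁺ (adjacent? G e) (Unique.allFin⁺ (E G))

  adjEdges-adjacent : ∀ e → All (Adjacent G e) (adjEdges G e)
  adjEdges-adjacent e = all-filter (adjacent? G e) (allFin (E G))

  ∈-adjEdges : ∀ {e f} → Adjacent G e f → f ∈ adjEdges G e
  ∈-adjEdges {e} = ∈-filter⁺ (adjacent? G e) (∈-allFin _)

  module _ {k} (c : Fin (E G) → Fin k) where

    adjEdgesOfColor-unique : ∀ e α → Unique (adjEdgesOfColor G c e α)
    adjEdgesOfColor-unique _ _ = Unique.filter⁺ _ (Unique.allFin⁺ (E G))

    adjEdgesOfColor-adjacent : ∀ e α →
      All (λ f → Adjacent G e f × c f ≡ α) (adjEdgesOfColor G c e α)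
    adjEdgesOfColor-adjacent _ _ = all-filter _ (allFin (E G))

    ∈-adjEdgesOfColor : ∀ {e α f} → Adjacent G e f → c f ≡ α → f ∈ adjEdgesOfColor G c e α
    ∈-adjEdgesOfColor adj cf≡α = ∈-filter⁺ _ (∈-allFin _) (adj , cf≡α)

module _ (h : ℕ → Fin 2) (alternating : ∀ j → h j ≢ h (2 + j)) where

  private
    ≢-≢⇒≡ : {x y z : Fin 2} → x ≢ y → y ≢ z → x ≡ z
    ≢-≢⇒≡ {zero}     {_}        {zero}     _   _   = refl
    ≢-≢⇒≡ {suc zero} {_}        {suc zero} _   _   = refl
    ≢-≢⇒≡ {zero}     {zero}     {suc zero} x≢y _   = contradiction refl x≢y
    ≢-≢⇒≡ {zero}     {suc zero} {suc zero} _   y≢z = contradiction refl y≢z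
    ≢-≢⇒≡ {suc zero} {zero}     {zero}     _   y≢z = contradiction refl y≢z
    ≢-≢⇒≡ {suc zero} {suc zero} {zero}     x≢y _   = contradiction refl x≢y

  alternating⇒4-periodic : ∀ j → h (4 + j) ≡ h j
  alternating⇒4-periodic j = sym (≢-≢⇒≡ (alternating j) (alternating (2 + j)))

  alternating-return⇒2∣ : ∀ t → h (2 * t) ≡ h 0 → 2 ∣ t
  alternating-return⇒2∣ zero          _         = divides 0 refl
  alternating-return⇒2∣ (suc zero)    h₂≡h₀     = contradiction (sym h₂≡h₀) (alternating 0)
  alternating-return⇒2∣ (suc (suc t)) returns with alternating-return⇒2∣ t (begin
    h (2 * t)        ≡⟨ alternating⇒4-periodic (2 * t) ⟨
    h (4 + 2 * t)    ≡⟨ cong h (*-distribˡ-+ 2 2 t) ⟨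
    h (2 * (2 + t))  ≡⟨ returns ⟩
    h 0              ∎)
    where open ≡-Reasoning
  ... | divides q t≡q*2 = divides (suc q) (cong (2 +_) t≡q*2)

  -- h (2n) = h 0 makes n = 2q even, and then h (2q) = h n = h 0 makes q even.
  alternating-period⇒4∣ : ∀ {n} → (∀ j → h (n + j) ≡ h j) → 4 ∣ n
  alternating-period⇒4∣ {n} periodic
    with alternating-return⇒2∣ n (trans (periodic (n + 0)) (periodic 0))
  ... | divides q n≡q*2 with alternating-return⇒2∣ q (begin
    h (2 * q)  ≡⟨ cong h (trans (*-comm 2 q) (sym n≡q*2)) ⟩
    h n        ≡⟨ cong h (+-identityʳ n) ⟨
    h (n + 0)  ≡⟨ periodic 0 ⟩
    h 0        ∎)
    where open ≡-Reasoning
  ... | divides r q≡r*2 = divides r (trans n≡q*2 (trans (cong (_* 2) q≡r*2) (*-assoc r 2 2)))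

stripes : ℕ → Fin 2
stripes 0 = zero
stripes 1 = zero
stripes 2 = suc zero
stripes 3 = suc zero
stripes (suc (suc (suc (suc j)))) = stripes j

stripes-alternating : ∀ j → stripes j ≢ stripes (2 + j)
stripes-alternating 0 = λ ()
stripes-alternating 1 = λ ()
stripes-alternating 2 = λ ()
stripes-alternating 3 = λ ()
stripes-alternating (suc (suc (suc (suc j)))) = stripes-alternating j

stripes-periodic : ∀ {n} → 4 ∣ n → ∀ j → stripes (n + j) ≡ stripes j
stripes-periodic (divides zero    refl) j = refl
stripes-periodic (divides (suc q) refl) j = stripes-periodic (divides q refl) j

module _ {m : ℕ} where

  private
    n : ℕ
    n = suc m

  mod-toℕ : (i : Fin n) → toℕ i mod n ≡ i
  mod-toℕ i = toℕ-injective (trans (toℕ-fromℕ< _) (m<n⇒m%n≡m (toℕ<n i)))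

  [k+j%n]mod≡[k+j]mod : ∀ k j → (k + j % n) mod n ≡ (k + j) mod n
  [k+j%n]mod≡[k+j]mod k j = fromℕ<-cong _ _ (begin
    (k + j % n) % n          ≡⟨ %-distribˡ-+ k (j % n) n ⟩
    (k % n + j % n % n) % n  ≡⟨ cong (λ r → (k % n + r) % n) (m%n%n≡m%n j n) ⟩
    (k % n + j % n) % n      ≡⟨ %-distribˡ-+ k j n ⟨
    (k + j) % n              ∎) _ _
    where open ≡-Reasoning

  [n+j]mod≡[j]mod : ∀ j → (n + j) mod n ≡ j mod n
  [n+j]mod≡[j]mod j = fromℕ<-cong _ _ (%-remove-+ˡ j n∣n) _ _

  next-mod : ∀ j → next (j mod n) ≡ suc j mod n
  next-mod j = trans (cong (λ r → suc r mod n) (toℕ-fromℕ< _)) ([k+j%n]mod≡[k+j]mod 1 j)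

  next²-mod : ∀ j → next (next (j mod n)) ≡ (2 + j) mod n
  next²-mod j = trans (cong next (next-mod j)) (next-mod (suc j))

  toℕ-next² : (i : Fin n) → toℕ (next (next i)) ≡ (2 + toℕ i) % n
  toℕ-next² i = trans (cong toℕ (next-mod (suc (toℕ i)))) (toℕ-fromℕ< _)

  prev : Fin n → Fin n
  prev i = (m + toℕ i) mod n

  next-prev : (i : Fin n) → next (prev i) ≡ i
  next-prev i = begin
    next ((m + toℕ i) mod n)  ≡⟨ next-mod (m + toℕ i) ⟩
    (n + toℕ i) mod n         ≡⟨ [n+j]mod≡[j]mod (toℕ i) ⟩
    toℕ i mod n               ≡⟨ mod-toℕ i ⟩
    i                         ∎
    where open ≡-Reasoning

  prev-next : (i : Fin n) → prev (next i) ≡ i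
  prev-next i = begin
    (m + toℕ (next i)) mod n     ≡⟨ cong (λ r → (m + r) mod n) (toℕ-fromℕ< _) ⟩
    (m + suc (toℕ i) % n) mod n  ≡⟨ [k+j%n]mod≡[k+j]mod m (suc (toℕ i)) ⟩
    (m + suc (toℕ i)) mod n      ≡⟨ cong (_mod n) (+-suc m (toℕ i)) ⟩
    (n + toℕ i) mod n            ≡⟨ [n+j]mod≡[j]mod (toℕ i) ⟩
    toℕ i mod n                  ≡⟨ mod-toℕ i ⟩
    i                            ∎
    where open ≡-Reasoning

  next-injective : ∀ {i j : Fin n} → next i ≡ next j → i ≡ j
  next-injective {i} {j} eq = trans (sym (prev-next i)) (trans (cong prev eq) (prev-next j))

  adjacent⇒next : ∀ {e f} → Adjacent (cycle n) e f → f ≡ next e ⊎ e ≡ next f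
  adjacent⇒next (e≢f , inj₁ (inj₁ e≡f))   = contradiction e≡f e≢f
  adjacent⇒next (_   , inj₁ (inj₂ e≡nf))  = inj₂ e≡nf
  adjacent⇒next (_   , inj₂ (inj₁ ne≡f))  = inj₁ (sym ne≡f)
  adjacent⇒next (e≢f , inj₂ (inj₂ ne≡nf)) = contradiction (next-injective ne≡nf) e≢f

  DistinctAtDistanceTwo : ∀ {k} → (Fin n → Fin k) → Set
  DistinctAtDistanceTwo c = ∀ p → c p ≢ c (next (next p))

module _ {m : ℕ} where

  private
    n : ℕ
    n = 3 + m

    G : Graph
    G = cycle n

  next²-cases : (i : Fin n) →
    (2 + toℕ i < n × toℕ (next (next i)) ≡ 2 + toℕ i) ⊎
    (2 + toℕ i ≡ n × toℕ (next (next i)) ≡ 0) ⊎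
    (1 + toℕ i ≡ n × toℕ (next (next i)) ≡ 1)
  next²-cases i with <-cmp (2 + toℕ i) n
  ... | tri< 2+i<n _ _ = inj₁ (2+i<n , trans (toℕ-next² i) (m<n⇒m%n≡m 2+i<n))
  ... | tri≈ _ 2+i≡n _ =
    inj₂ (inj₁ (2+i≡n , trans (toℕ-next² i) (trans (cong (_% n) 2+i≡n) (n%n≡0 n))))
  ... | tri> _ _ 2+i>n = inj₂ (inj₂ (1+i≡n , (begin
    toℕ (next (next i))  ≡⟨ toℕ-next² i ⟩
    (2 + toℕ i) % n      ≡⟨ cong (λ r → suc r % n) 1+i≡n ⟩
    (1 + n) % n          ≡⟨ [m+n]%n≡m%n 1 n ⟩
    1 % n                ≡⟨ m<n⇒m%n≡m {n = n} (s≤s (s≤s z≤n)) ⟩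
    1                    ∎)))
    where
    open ≡-Reasoning
    1+i≡n : 1 + toℕ i ≡ n
    1+i≡n = ≤-antisym (toℕ<n i) (s≤s⁻¹ 2+i>n)

  next²≢ : (i : Fin n) → next (next i) ≢ i
  next²≢ i eq with next²-cases i | cong toℕ eq
  ... | inj₁ (_ , to≡2+i)            | to≡i = m≢1+n+m (toℕ i) (trans (sym to≡i) to≡2+i)
  ... | inj₂ (inj₁ (2+i≡n , to≡0))  | to≡i
    with () ← trans (cong (2 +_) (trans (sym to≡0) to≡i)) 2+i≡n
  ... | inj₂ (inj₂ (1+i≡n , to≡1))  | to≡i
    with () ← trans (cong (1 +_) (trans (sym to≡1) to≡i)) 1+i≡n

  next≢ : (i : Fin n) → next i ≢ i
  next≢ i eq = next²≢ i (trans (cong next eq) eq)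

  adjacent-next : (e : Fin n) → Adjacent G e (next e)
  adjacent-next e = ≢-sym (next≢ e) , inj₂ (inj₁ refl)

  next-adjacent : (e : Fin n) → Adjacent G (next e) e
  next-adjacent e = next≢ e , inj₁ (inj₂ refl)

  adjEdges-length : (e : Fin n) → length (adjEdges G e) ≡ 2
  adjEdges-length e = ≤-antisym atMostTwo atLeastTwo
    where
    atMostTwo : length (adjEdges G e) ≤ 2
    atMostTwo = AtMostOne-∪⇒length≤2
      (λ f≡ne g≡ne → trans f≡ne (sym g≡ne))
      (λ e≡nf e≡ng → next-injective (trans (sym e≡nf) e≡ng))
      (adjEdges-unique G e) (All.map adjacent⇒next (adjEdges-adjacent G e))
    prev-adjacent : Adjacent G e (prev e)
    prev-adjacent = subst (λ x → Adjacent G x (prev e)) (next-prev e) (next-adjacent (prev e))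
    next≢prev : next e ≢ prev e
    next≢prev ne≡pe = next²≢ e (trans (cong next ne≡pe) (next-prev e))
    atLeastTwo : 2 ≤ length (adjEdges G e)
    atLeastTwo =
      ≢-∈⇒2≤length next≢prev (∈-adjEdges G (adjacent-next e)) (∈-adjEdges G prev-adjacent)

  module _ {k} {c : Fin n → Fin k} where

    adjEdgesOfColor-length≤1 : DistinctAtDistanceTwo c → ∀ e α →
      length (adjEdgesOfColor G c e α) ≤ 1
    adjEdgesOfColor-length≤1 distinct e α = AtMostOne⇒length≤1 sameColor
      (adjEdgesOfColor-unique G c e α) (adjEdgesOfColor-adjacent G c e α)
      where
      sameColor : AtMostOne (λ f → Adjacent G e f × c f ≡ α)
      sameColor {f} {g} (adj-f , cf≡α) (adj-g , cg≡α) with adjacent⇒next adj-f | adjacent⇒next adj-g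
      ... | inj₁ f≡ne  | inj₁ g≡ne  = trans f≡ne (sym g≡ne)
      ... | inj₂ e≡nf  | inj₂ e≡ng  = next-injective (trans (sym e≡nf) e≡ng)
      ... | inj₁ f≡ne  | inj₂ e≡ng  = contradiction
        (trans cg≡α (trans (sym cf≡α) (cong c (trans f≡ne (cong next e≡ng))))) (distinct g)
      ... | inj₂ e≡nf  | inj₁ g≡ne  = contradiction
        (trans cf≡α (trans (sym cg≡α) (cong c (trans g≡ne (cong next e≡nf))))) (distinct f)

    isStrongMajority⇒distinct : IsStrongMajority G c → DistinctAtDistanceTwo c
    isStrongMajority⇒distinct sm p cp≡cnnp = contradiction (begin
      4                                                 ≤⟨ *-monoʳ-≤ 2 twoOfColor ⟩
      2 * length (adjEdgesOfColor G c (next p) (c p))   ≤⟨ sm (next p) (c p) ⟩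
      length (adjEdges G (next p))                      ≡⟨ adjEdges-length (next p) ⟩
      2                                                 ∎) λ { (s≤s (s≤s ())) }
      where
      open ≤-Reasoning
      twoOfColor : 2 ≤ length (adjEdgesOfColor G c (next p) (c p))
      twoOfColor = ≢-∈⇒2≤length (≢-sym (next²≢ p))
        (∈-adjEdgesOfColor G c (next-adjacent p) refl)
        (∈-adjEdgesOfColor G c (adjacent-next (next p)) (sym cp≡cnnp))

    distinct⇒isStrongMajority : DistinctAtDistanceTwo c → IsStrongMajority G c
    distinct⇒isStrongMajority distinct e α = begin
      2 * length (adjEdgesOfColor G c e α)  ≤⟨ *-monoʳ-≤ 2 (adjEdgesOfColor-length≤1 distinct e α) ⟩
      2                                     ≡⟨ adjEdges-length e ⟨
      length (adjEdges G e)                 ∎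
      where open ≤-Reasoning

  distinctAtDistanceTwo-fromℕ : ∀ {k} (g : ℕ → Fin k) →
    (∀ a → 2 + a < n → g a ≢ g (2 + a)) →
    (∀ a → 2 + a ≡ n → g a ≢ g 0) →
    (∀ a → 1 + a ≡ n → g a ≢ g 1) →
    DistinctAtDistanceTwo (g ∘ toℕ)
  distinctAtDistanceTwo-fromℕ g inner wrap₀ wrap₁ p with next²-cases p
  ... | inj₁ (2+p<n , to≡2+p)       rewrite to≡2+p = inner (toℕ p) 2+p<n
  ... | inj₂ (inj₁ (2+p≡n , to≡0))  rewrite to≡0   = wrap₀ (toℕ p) 2+p≡n
  ... | inj₂ (inj₂ (1+p≡n , to≡1))  rewrite to≡1   = wrap₁ (toℕ p) 1+p≡n

  periodic⇒distinctAtDistanceTwo : ∀ {k} (g : ℕ → Fin k) →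
    (∀ j → g j ≢ g (2 + j)) → (∀ j → g (n + j) ≡ g j) → DistinctAtDistanceTwo (g ∘ toℕ)
  periodic⇒distinctAtDistanceTwo g alternating periodic =
    distinctAtDistanceTwo-fromℕ g (λ a _ → alternating a) wrap₀ wrap₁
    where
    wrap₀ : ∀ a → 2 + a ≡ n → g a ≢ g 0
    wrap₀ a 2+a≡n = subst (g a ≢_)
      (trans (cong g (trans 2+a≡n (sym (+-identityʳ n)))) (periodic 0)) (alternating a)
    wrap₁ : ∀ a → 1 + a ≡ n → g a ≢ g 1
    wrap₁ a 1+a≡n = subst (g a ≢_)
      (trans (cong g (trans (cong suc 1+a≡n) (+-comm 1 n))) (periodic 1)) (alternating a)

  hasStrongMajorityColoring-mono : ∀ {j k} → j ≤ k →
    HasStrongMajorityColoring G j → HasStrongMajorityColoring G k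
  hasStrongMajorityColoring-mono j≤k (c , sm) =
    (λ p → inject≤ (c p) j≤k) ,
    distinct⇒isStrongMajority (λ p → isStrongMajority⇒distinct sm p ∘ inject≤-injective j≤k j≤k _ _)

  majIndexIs-intro : ∀ {k} → HasStrongMajorityColoring G (suc k) → ¬ HasStrongMajorityColoring G k →
    MajIndexIs G (suc k)
  majIndexIs-intro colorable ¬colorable =
    colorable , λ j j<1+k → ¬colorable ∘ hasStrongMajorityColoring-mono (s≤s⁻¹ j<1+k)

  ¬oneColorable : ¬ HasStrongMajorityColoring G 1
  ¬oneColorable (c , sm) =
    isStrongMajority⇒distinct sm zero (allEqual (c zero) (c (next (next zero))))
    where
    allEqual : (x y : Fin 1) → x ≡ y
    allEqual zero zero = refl

  twoColorable⇒4∣n : HasStrongMajorityColoring G 2 → 4 ∣ n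
  twoColorable⇒4∣n (c , sm) =
    alternating-period⇒4∣ (λ j → c (j mod n)) alternating (cong c ∘ [n+j]mod≡[j]mod)
    where
    alternating : ∀ j → c (j mod n) ≢ c ((2 + j) mod n)
    alternating j =
      subst (λ q → c (j mod n) ≢ c q) (next²-mod j) (isStrongMajority⇒distinct sm (j mod n))

  4∣n⇒twoColorable : 4 ∣ n → HasStrongMajorityColoring G 2
  4∣n⇒twoColorable 4∣n =
    stripes ∘ toℕ ,
    distinct⇒isStrongMajority
      (periodic⇒distinctAtDistanceTwo stripes stripes-alternating (stripes-periodic 4∣n))

module _ {m : ℕ} where

  private
    n : ℕ
    n = 4 + m

  stripesWithTail : ℕ → Fin 3
  stripesWithTail a with 2 + a <? n
  ... | yes _ = inject₁ (stripes a)
  ... | no _  = fromℕ 2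

  private
    stripesWithTail-low : ∀ {a} → 2 + a < n → stripesWithTail a ≡ inject₁ (stripes a)
    stripesWithTail-low {a} 2+a<n with 2 + a <? n
    ... | yes _     = refl
    ... | no 2+a≮n  = contradiction 2+a<n 2+a≮n

    stripesWithTail-high : ∀ {a} → ¬ 2 + a < n → stripesWithTail a ≡ fromℕ 2
    stripesWithTail-high {a} 2+a≮n with 2 + a <? n
    ... | yes 2+a<n = contradiction 2+a<n 2+a≮n
    ... | no _      = refl

    low≢high : ∀ {a b} → 2 + a < n → ¬ 2 + b < n → stripesWithTail a ≢ stripesWithTail b
    low≢high 2+a<n 2+b≮n eq = fromℕ≢inject₁
      (trans (sym (stripesWithTail-high 2+b≮n)) (trans (sym eq) (stripesWithTail-low 2+a<n)))

  stripesWithTail-distinct : DistinctAtDistanceTwo (stripesWithTail ∘ toℕ)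
  stripesWithTail-distinct = distinctAtDistanceTwo-fromℕ stripesWithTail inner wrap₀ wrap₁
    where
    inner : ∀ a → 2 + a < n → stripesWithTail a ≢ stripesWithTail (2 + a)
    inner a 2+a<n = case 4 + a <? n of λ where
      (yes 4+a<n) eq → stripes-alternating a (inject₁-injective
        (trans (sym (stripesWithTail-low 2+a<n)) (trans eq (stripesWithTail-low 4+a<n))))
      (no 4+a≮n) → low≢high 2+a<n 4+a≮n
    wrap₀ : ∀ a → 2 + a ≡ n → stripesWithTail a ≢ stripesWithTail 0
    wrap₀ a 2+a≡n = ≢-sym (low≢high (m≤m+n 3 (suc m)) (<-irrefl 2+a≡n))
    wrap₁ : ∀ a → 1 + a ≡ n → stripesWithTail a ≢ stripesWithTail 1
    wrap₁ a 1+a≡n = ≢-sym (low≢high (m≤m+n 4 m)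
      (λ 2+a<n → <-asym (n<1+n (1 + a)) (subst (2 + a <_) (sym 1+a≡n) 2+a<n)))

threeColorable : ∀ m → HasStrongMajorityColoring (cycle (3 + m)) 3
threeColorable zero    = id , distinct⇒isStrongMajority (λ p → ≢-sym (next²≢ p))
threeColorable (suc m) = stripesWithTail ∘ toℕ , distinct⇒isStrongMajority stripesWithTail-distinct

mainTheorem5 : (n : ℕ) → 3 ≤ n →
    (n % 4 ≡ 0 → MajIndexIs (cycle n) 2) ×
    (¬ (n % 4 ≡ 0) → MajIndexIs (cycle n) 3)
mainTheorem5 0                   ()
mainTheorem5 1                   (s≤s ())
mainTheorem5 2                   (s≤s (s≤s ()))
mainTheorem5 (suc (suc (suc m))) _ =
  (λ n%4≡0 → majIndexIs-intro (4∣n⇒twoColorable (m%n≡0⇒n∣m _ 4 n%4≡0)) ¬oneColorable) ,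
  (λ n%4≢0 → majIndexIs-intro (threeColorable m) (n%4≢0 ∘ n∣m⇒m%n≡0 _ 4 ∘ twoColorable⇒4∣n))
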